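{- Let $S,T$ be finite ordered trees and let $s\colon T\to S$ be a rigid surjection and $i\colon S\to T$ an embedding with $s\circ i=\mathrm{Id}_S$. If $x\in S$ has at least two immediate successors in $S$, then $i(x)=i_s(x)$.
   Context: A tree is a partial order $(T,\sqsubseteq_T)$ with a least element (the root) such that the predecessors of every element are linearly ordered; $v\wedge_T w$ is the largest common predecessor. A tree is ordered if each set of immediate successors carries a linear order; this induces a linear order $\leq_T$ on $T$: $v\leq_T w$ iff $v\sqsubseteq_T w$, or $w\not\sqsubseteq_T v$ and the immediate successor of $v\wedge w$ below $v$ precedes the one below $w$. An embedding $i\colon S\to T$ sends root to root, satisfies $x<_S y\Rightarrow i(x)<_T i(y)$, and $i(x\wedge y)=i(x)\wedge i(y)$. A map $s\colon T\to S$ is a rigid surjection if there is an embedding $i\colon S\to T$ with $s(i(x))=x$ and $i(s(y))\sqsubseteq_T y$ for all $x\in S,y\in T$; this embedding is unique and equals $i_s$, where $i_s(x)=\bigwedge s^{ -1}(x)$ (the $\sqsubseteq_T$-meet of the fiber). -}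

module Defs where

open import Data.Nat using (ℕ)
open import Data.Fin using (Fin)
open import Data.Product using (Σ; ∃; ∃-syntax; _×_; _,_)
open import Data.Sum using (_⊎_)
open import Relation.Binary.PropositionalEquality using (_≡_; _≢_)
open import Relation.Nullary using (¬_)
open import Level using (0ℓ) renaming (suc to lsuc)

-- The carrier is Fin size (finite).
-- _⊑_ is the tree order; _◁_ is the order on siblings: it is required to
-- be a strict linear order on every set of immediate successors of a node
-- (its values on non-siblings are irrelevant).
record OrderedTree : Set₁ where
  field
    size    : ℕ
    _⊑_     : Fin size → Fin size → Set
    ⊑-refl  : ∀ {x} → x ⊑ x
    ⊑-trans : ∀ {x y z} → x ⊑ y → y ⊑ z → x ⊑ z
    ⊑-antisym : ∀ {x y} → x ⊑ y → y ⊑ x → x ≡ y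
    root    : Fin size
    root-least : ∀ x → root ⊑ x
    preds-linear : ∀ {x y z} → x ⊑ z → y ⊑ z → (x ⊑ y) ⊎ (y ⊑ x)

  ImmSucc : Fin size → Fin size → Set
  ImmSucc v w = (v ⊑ w) × (v ≢ w) × (∀ u → v ⊑ u → u ⊑ w → (u ≡ v) ⊎ (u ≡ w))

  field
    _◁_       : Fin size → Fin size → Set
    ◁-irrefl  : ∀ {p a} → ImmSucc p a → ¬ (a ◁ a)
    ◁-trans   : ∀ {p a b c} → ImmSucc p a → ImmSucc p b → ImmSucc p c →
                a ◁ b → b ◁ c → a ◁ c
    ◁-total   : ∀ {p a b} → ImmSucc p a → ImmSucc p b →
                (a ◁ b) ⊎ (a ≡ b) ⊎ (b ◁ a)

  IsMeet : Fin size → Fin size → Fin size → Set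
  IsMeet v w m = (m ⊑ v) × (m ⊑ w) × (∀ u → u ⊑ v → u ⊑ w → u ⊑ m)

  IsInf : (Fin size → Set) → Fin size → Set
  IsInf P m = (∀ y → P y → m ⊑ y) × (∀ u → (∀ y → P y → u ⊑ y) → u ⊑ m)

  _≤T_ : Fin size → Fin size → Set
  v ≤T w = (v ⊑ w) ⊎
           ((¬ (w ⊑ v)) × ∃[ m ] ∃[ a ] ∃[ b ]
              (IsMeet v w m × ImmSucc m a × a ⊑ v × ImmSucc m b × b ⊑ w × a ◁ b))

  _<T_ : Fin size → Fin size → Set
  v <T w = (v ≤T w) × (v ≢ w)

open OrderedTree public

record IsEmbedding (S T : OrderedTree) (i : Fin (size S) → Fin (size T)) : Set where
  field
    root-pres : i (root S) ≡ root T
    <-pres    : ∀ {x y} → _<T_ S x y → _<T_ T (i x) (i y)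
    meet-pres : ∀ {x y m} → IsMeet S x y m → IsMeet T (i x) (i y) (i m)

IsRigidSurjection : (T S : OrderedTree) → (Fin (size T) → Fin (size S)) → Set
IsRigidSurjection T S s =
  Σ (Fin (size S) → Fin (size T)) λ j →
    IsEmbedding S T j × (∀ x → s (j x) ≡ x) × (∀ y → _⊑_ T (j (s y)) y)

-- i_s(x) = ⊑-meet of the fibre s⁻¹(x); "i_s x ≡ t" is expressed as
-- "t is the meet of the fibre"
IsIs : (T S : OrderedTree) → (Fin (size T) → Fin (size S)) →
       Fin (size S) → Fin (size T) → Set
IsIs T S s x t = IsInf T (λ y → s y ≡ x) t

{-# OPTIONS --safe #-}
-- Let a ≢ b be immediate successors of x, so that x = a ∧ b.  Both embeddings
-- preserve this meet, and iₛ a ⊑ i a, iₛ b ⊑ i b because iₛ lies below every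
-- fibre.  The meet iₛ x is in the fibre of x, not of a or b, so iₛ a and iₛ b
-- are incomparable.  Now i x and iₛ a are comparable below i a, and
-- iₛ a ⊑ i x ⊑ i b would make iₛ a and iₛ b comparable below i b; hence
-- i x ⊑ iₛ a, symmetrically i x ⊑ iₛ b, so i x ⊑ iₛ x.  Thus i x lies in the
-- fibre of x and below all of it.
module Submission where

open import Data.Fin using (Fin)
open import Data.Product using (∃-syntax; _×_; _,_; proj₁; proj₂; swap)
open import Data.Sum using (inj₁; inj₂)
open import Relation.Nullary using (¬_; contradiction)
open import Relation.Binary.PropositionalEquality using (_≡_; _≢_; refl; sym; trans; cong)

open import Defs using (OrderedTree; module OrderedTree; IsEmbedding; IsRigidSurjection; IsIs)

module TreeProperties (T : OrderedTree) where
  open OrderedTree T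

  Incomparable : Fin size → Fin size → Set
  Incomparable v w = ¬ (v ⊑ w) × ¬ (w ⊑ v)

  siblings-meet : ∀ {x a b} → a ≢ b → ImmSucc x a → ImmSucc x b → IsMeet a b x
  siblings-meet {x} {a} {b} a≢b (x⊑a , x≢a , a-cover) (x⊑b , _ , b-cover) =
    x⊑a , x⊑b , below-x
    where
    below-x : ∀ u → u ⊑ a → u ⊑ b → u ⊑ x
    below-x u u⊑a u⊑b with preds-linear u⊑a x⊑a
    ... | inj₁ u⊑x = u⊑x
    ... | inj₂ x⊑u with a-cover u x⊑u u⊑a
    ...   | inj₁ refl = ⊑-refl
    ...   | inj₂ refl with b-cover a x⊑u u⊑b
    ...     | inj₁ a≡x = contradiction (sym a≡x) x≢a
    ...     | inj₂ a≡b = contradiction a≡b a≢b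

  meet-≡ˡ : ∀ {v w m} → IsMeet v w m → v ⊑ w → m ≡ v
  meet-≡ˡ (m⊑v , _ , greatest) v⊑w = ⊑-antisym m⊑v (greatest _ ⊑-refl v⊑w)

  meet-≡ʳ : ∀ {v w m} → IsMeet v w m → w ⊑ v → m ≡ w
  meet-≡ʳ (_ , m⊑w , greatest) w⊑v = ⊑-antisym m⊑w (greatest _ w⊑v ⊑-refl)

  meet-incomparable : ∀ {v w m} → IsMeet v w m → m ≢ v → m ≢ w → Incomparable v w
  meet-incomparable meet m≢v m≢w =
    (λ v⊑w → m≢v (meet-≡ˡ meet v⊑w)) , (λ w⊑v → m≢w (meet-≡ʳ meet w⊑v))

  below-incomparable : ∀ {p q P Q z} → Incomparable p q →
                       z ⊑ P → p ⊑ P → z ⊑ Q → q ⊑ Q → z ⊑ p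
  below-incomparable (p⋢q , q⋢p) z⊑P p⊑P z⊑Q q⊑Q with preds-linear z⊑P p⊑P
  ... | inj₁ z⊑p = z⊑p
  ... | inj₂ p⊑z with preds-linear (⊑-trans p⊑z z⊑Q) q⊑Q
  ...   | inj₁ p⊑q = contradiction p⊑q p⋢q
  ...   | inj₂ q⊑p = contradiction q⊑p q⋢p

  below-meet-of-incomparable : ∀ {p q m P Q z} → Incomparable p q → IsMeet p q m →
                               z ⊑ P → p ⊑ P → z ⊑ Q → q ⊑ Q → z ⊑ m
  below-meet-of-incomparable p⋈q (_ , _ , greatest) z⊑P p⊑P z⊑Q q⊑Q =
    greatest _ (below-incomparable p⋈q z⊑P p⊑P z⊑Q q⊑Q)
               (below-incomparable (swap p⋈q) z⊑Q q⊑Q z⊑P p⊑P)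

  least-IsInf : ∀ {P : Fin size → Set} {m} → P m → (∀ y → P y → m ⊑ y) → IsInf P m
  least-IsInf Pm m-lower = m-lower , λ u u-lower → u-lower _ Pm

open OrderedTree using (size; _⊑_; ImmSucc)

module RigidSurjection {T S : OrderedTree} {s : Fin (size T) → Fin (size S)}
                      (rigid : IsRigidSurjection T S s) where

  iₛ : Fin (size S) → Fin (size T)
  iₛ = proj₁ rigid

  iₛ-embedding : IsEmbedding S T iₛ
  iₛ-embedding = proj₁ (proj₂ rigid)

  s∘iₛ : ∀ x → s (iₛ x) ≡ x
  s∘iₛ = proj₁ (proj₂ (proj₂ rigid))

  iₛ∘s-⊑ : ∀ y → _⊑_ T (iₛ (s y)) y
  iₛ∘s-⊑ = proj₂ (proj₂ (proj₂ rigid))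

  iₛ-injective : ∀ {x x′} → iₛ x ≡ iₛ x′ → x ≡ x′
  iₛ-injective {x} {x′} eq = trans (sym (s∘iₛ x)) (trans (cong s eq) (s∘iₛ x′))

  iₛ-below-fibre : ∀ {x y} → s y ≡ x → _⊑_ T (iₛ x) y
  iₛ-below-fibre {y = y} refl = iₛ∘s-⊑ y

lemma4p1 : (S T : OrderedTree) (s : Fin (size T) → Fin (size S))
    (i : Fin (size S) → Fin (size T)) →
    IsRigidSurjection T S s → IsEmbedding S T i → (∀ x → s (i x) ≡ x) →
    (x : Fin (size S)) →
    (∃[ a ] ∃[ b ] (a ≢ b × ImmSucc S x a × ImmSucc S x b)) →
    IsIs T S s x (i x)
lemma4p1 S T s i rigid i-emb s∘i x (a , b , a≢b , x⋖a , x⋖b) =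
  least-IsInf (s∘i x) (λ y sy≡x → ⊑-trans ix⊑iₛx (iₛ-below-fibre sy≡x))
  where
  open TreeProperties T
  open OrderedTree T using (⊑-trans; IsMeet)
  open RigidSurjection rigid

  x-meet : OrderedTree.IsMeet S a b x
  x-meet = TreeProperties.siblings-meet S a≢b x⋖a x⋖b

  ix-meet : IsMeet (i a) (i b) (i x)
  ix-meet = IsEmbedding.meet-pres i-emb x-meet

  iₛx-meet : IsMeet (iₛ a) (iₛ b) (iₛ x)
  iₛx-meet = IsEmbedding.meet-pres iₛ-embedding x-meet

  iₛa⋈iₛb : Incomparable (iₛ a) (iₛ b)
  iₛa⋈iₛb = meet-incomparable iₛx-meet
    (λ iₛx≡iₛa → proj₁ (proj₂ x⋖a) (iₛ-injective iₛx≡iₛa))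
    (λ iₛx≡iₛb → proj₁ (proj₂ x⋖b) (iₛ-injective iₛx≡iₛb))

  ix⊑iₛx : _⊑_ T (i x) (iₛ x)
  ix⊑iₛx = below-meet-of-incomparable iₛa⋈iₛb iₛx-meet
    (proj₁ ix-meet) (iₛ-below-fibre (s∘i a))
    (proj₁ (proj₂ ix-meet)) (iₛ-below-fibre (s∘i b))
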